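{- In the random vertex order model, there is an online algorithm for $\mathsf{MinCut}$ that is $O(1)$-competitive in expectation on sparse connected graphs, i.e. connected graphs with $O(n)$ edges, where $n$ is the number of vertices.
   Context: For a simple graph $G=(V,E)$, a cut is the set of edges between the parts of a partition $(X,Y)$ of $V$ with $X\ne\emptyset\ne Y$; $opt(G)$ is the minimum cut size. In the online vertex arrival model, vertices are revealed one by one, each with its edges to previously revealed vertices, and the algorithm irrevocably assigns each vertex to $X$ or $Y$; $\mathbf A(G,\pi)$ is the size of the final cut. In the random vertex order model, $G$ is chosen adversarially (here from the given class) and the arrival order $\pi$ is a uniformly random permutation. An algorithm is $c$-competitive in expectation if $\mathbb E_\pi[\mathbf A(G,\pi)]\le c\cdot opt(G)+d$ for all admissible $G$, with $d$ a constant independent of $G$. -}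

module Defs where

open import Data.Nat using (ℕ; zero; suc; _+_; _*_; _≤_; _≡ᵇ_; _<ᵇ_)
open import Data.Bool using (Bool; true; false; _∧_; _∨_; not; _xor_; if_then_else_)
open import Data.Fin using (Fin; toℕ; inject₁; fromℕ)
open import Data.Vec using (Vec; []; _∷_; _∷ʳ_; lookup)
open import Data.List using (List; []; _∷_; map; concatMap; allFin; filterᵇ; length)
open import Data.Nat.ListAction using (sum)
open import Data.Bool.ListAction using (all; any)
open import Data.Product using (Σ; _×_; ∃)
open import Relation.Binary.PropositionalEquality using (_≡_)

_==_ : ∀ {n} → Fin n → Fin n → Bool
i == j = toℕ i ≡ᵇ toℕ j

count : (n : ℕ) → (Fin n → Bool) → ℕ
count n p = length (filterᵇ p (allFin n))

record Graph (n : ℕ) : Set where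
  field
    adj    : Fin n → Fin n → Bool
    sym    : ∀ i j → adj i j ≡ adj j i
    irrefl : ∀ i → adj i i ≡ false
open Graph public

numEdges : ∀ {n} → Graph n → ℕ
numEdges {n} G = sum (map (λ i → count n (λ j → (toℕ i <ᵇ toℕ j) ∧ adj G i j)) (allFin n))

data Walk {n : ℕ} (G : Graph n) : Fin n → Fin n → Set where
  here : ∀ {i} → Walk G i i
  step : ∀ {i j k} → adj G i j ≡ true → Walk G j k → Walk G i k

Connected : ∀ {n} → Graph n → Set
Connected G = ∀ i j → Walk G i j

-- a partition (X,Y) of V, given by s v = true iff v ∈ X
Partition : ℕ → Set
Partition n = Fin n → Bool

ValidPartition : ∀ {n} → Partition n → Set
ValidPartition {n} s = (∃ λ v → s v ≡ true) × (∃ λ v → s v ≡ false)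

cutSize : ∀ {n} → Graph n → Partition n → ℕ
cutSize {n} G s =
  sum (map (λ i → count n (λ j → (toℕ i <ᵇ toℕ j) ∧ adj G i j ∧ (s i xor s j))) (allFin n))

IsMinCut : ∀ {n} → Graph n → ℕ → Set
IsMinCut {n} G k =
  (Σ (Partition n) λ s → ValidPartition s × cutSize G s ≡ k)
  × (∀ (s : Partition n) → ValidPartition s → k ≤ cutSize G s)

-- A (deterministic) online algorithm in the vertex arrival model.
-- When the (k+1)-st vertex arrives, it sees: its own earlier decisions for the k
-- previously revealed vertices, the adjacency among those k vertices, and the
-- edges from the new vertex to them; it outputs true (put into X) or false (Y).
OnlineAlg : Set
OnlineAlg = (k : ℕ) → Vec Bool k → (Fin k → Fin k → Bool) → (Fin k → Bool) → Bool

-- run the algorithm on the arrival sequence f(0), ..., f(k-1); decisions by arrival position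
run : ∀ {n} → OnlineAlg → Graph n → (k : ℕ) → (Fin k → Fin n) → Vec Bool k
run A G zero f = []
run A G (suc k) f =
  let prev = run A G k (λ i → f (inject₁ i)) in
  prev ∷ʳ A k prev (λ i j → adj G (f (inject₁ i)) (f (inject₁ j)))
                   (λ i → adj G (f (fromℕ k)) (f (inject₁ i)))

-- arrival orders: π is a vector listing the vertices in order of arrival
isPerm : ∀ {n} → Vec (Fin n) n → Bool
isPerm {n} π = all (λ i → all (λ j → (i == j) ∨ not (lookup π i == lookup π j)) (allFin n)) (allFin n)

allVecs : ∀ {A : Set} (m : ℕ) → List A → List (Vec A m)
allVecs zero xs = [] ∷ []
allVecs (suc m) xs = concatMap (λ x → map (x ∷_) (allVecs m xs)) xs

perms : (n : ℕ) → List (Vec (Fin n) n)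
perms n = filterᵇ isPerm (allVecs n (allFin n))

finalPartition : ∀ {n} → OnlineAlg → Graph n → Vec (Fin n) n → Partition n
finalPartition {n} A G π v =
  let d = run A G n (lookup π) in
  any (λ t → (lookup π t == v) ∧ lookup d t) (allFin n)

algCost : ∀ {n} → OnlineAlg → Graph n → Vec (Fin n) n → ℕ
algCost A G π = cutSize G (finalPartition A G π)

-- Σ_π 𝐀(G,π) over all permutations (expectation = this / number of permutations)
totalCost : ∀ {n} → OnlineAlg → Graph n → ℕ
totalCost {n} A G = sum (map (algCost A G) (perms n))

module Submission where

-- The algorithm puts the first arriving vertex into X and every later vertex into Y,
-- so its final cut is the star of the first vertex, of size deg(first vertex).  Under a
-- uniformly random arrival order the first vertex is uniformly distributed, hence the
-- expected cost is the average degree 2|E|/n ≤ 2C on graphs with |E| ≤ C·n.  Thus the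
-- algorithm is competitive with c = 0 and additive constant d = 2C (and, as opt ≥ 1 on a
-- connected graph, with ratio 2C); for n ≥ 2 both parts of its partition are non-empty.

open import Defs
open import Data.Nat using (ℕ; _+_; _*_; _≤_)
open import Data.Bool using (true)
open import Data.Fin using (Fin)
open import Data.Vec using (Vec)
open import Data.List using (length)
open import Data.Product using (Σ; _×_)
open import Relation.Binary.PropositionalEquality using (_≡_)

open import Data.Nat using (zero; suc; z≤n; s≤s; _≡ᵇ_; _<ᵇ_)
open import Data.Nat.Properties
open import Data.Nat.Tactic.RingSolver using (solve-∀)
open import Algebra.Properties.CommutativeSemigroup +-commutativeSemigroup using (interchange)
open import Data.Bool using (Bool; false; _∧_; _∨_; not; _xor_; if_then_else_)
open import Data.Bool.Properties using (∧-identityʳ; ∨-identityʳ; ∧-zeroʳ; T-≡)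
open import Data.Fin as F using (toℕ)
open import Data.Fin.Properties using (toℕ-injective)
open import Data.Vec as V using (_∷_; lookup)
open import Data.Vec.Properties using (lookup-map; lookup-replicate)
open import Data.List as L using (List; map; allFin; filterᵇ; concatMap; tabulate)
open import Data.List.Properties using (map-tabulate; length-tabulate)
open import Data.Nat.ListAction using (sum)
open import Data.Bool.ListAction using (all; any)
open import Data.Product using (_,_)
open import Function using (_∘_; id)
open import Function.Bundles using (Equivalence)
open import Relation.Binary.PropositionalEquality
  using (refl; trans; cong; cong₂; module ≡-Reasoning) renaming (sym to ≡-sym)

⟦_⟧ : Bool → ℕ
⟦ true ⟧ = 1
⟦ false ⟧ = 0

∑ : ∀ {A : Set} → List A → (A → ℕ) → ℕ
∑ xs f = sum (map f xs)

∑-cong : ∀ {A : Set} (xs : List A) {f g : A → ℕ} → (∀ x → f x ≡ g x) → ∑ xs f ≡ ∑ xs g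
∑-cong L.[] e = refl
∑-cong (x L.∷ xs) e = cong₂ _+_ (e x) (∑-cong xs e)

∑-mono : ∀ {A : Set} (xs : List A) {f g : A → ℕ} → (∀ x → f x ≤ g x) → ∑ xs f ≤ ∑ xs g
∑-mono L.[] e = z≤n
∑-mono (x L.∷ xs) e = +-mono-≤ (e x) (∑-mono xs e)

∑-const : ∀ {A : Set} (xs : List A) (c : ℕ) → ∑ xs (λ _ → c) ≡ length xs * c
∑-const L.[] c = refl
∑-const (x L.∷ xs) c = cong (c +_) (∑-const xs c)

∑-+ : ∀ {A : Set} (xs : List A) (f g : A → ℕ) → ∑ xs (λ x → f x + g x) ≡ ∑ xs f + ∑ xs g
∑-+ L.[] f g = refl
∑-+ (x L.∷ xs) f g =
  trans (cong (f x + g x +_) (∑-+ xs f g)) (interchange (f x) (g x) (∑ xs f) (∑ xs g))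

∑-*ˡ : ∀ {A : Set} (xs : List A) (c : ℕ) (f : A → ℕ) → ∑ xs (λ x → c * f x) ≡ c * ∑ xs f
∑-*ˡ L.[] c f = ≡-sym (*-zeroʳ c)
∑-*ˡ (x L.∷ xs) c f = trans (cong (c * f x +_) (∑-*ˡ xs c f)) (≡-sym (*-distribˡ-+ c (f x) (∑ xs f)))

∑-*ʳ : ∀ {A : Set} (xs : List A) (f : A → ℕ) (c : ℕ) → ∑ xs (λ x → f x * c) ≡ ∑ xs f * c
∑-*ʳ xs f c =
  trans (∑-cong xs (λ x → *-comm (f x) c)) (trans (∑-*ˡ xs c f) (*-comm c (∑ xs f)))

∑-swap : ∀ {A B : Set} (xs : List A) (ys : List B) (f : A → B → ℕ) →
  ∑ xs (λ x → ∑ ys (f x)) ≡ ∑ ys (λ y → ∑ xs (λ x → f x y))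
∑-swap L.[] ys f = ≡-sym (trans (∑-const ys 0) (*-zeroʳ (length ys)))
∑-swap (x L.∷ xs) ys f =
  trans (cong (∑ ys (f x) +_) (∑-swap xs ys f)) (≡-sym (∑-+ ys (f x) (λ y → ∑ xs (λ x → f x y))))

∑-filter : ∀ {A : Set} (p : A → Bool) (xs : List A) (f : A → ℕ) →
  ∑ (filterᵇ p xs) f ≡ ∑ xs (λ x → ⟦ p x ⟧ * f x)
∑-filter p L.[] f = refl
∑-filter p (x L.∷ xs) f with p x
... | true = cong₂ _+_ (≡-sym (+-identityʳ (f x))) (∑-filter p xs f)
... | false = ∑-filter p xs f

length-filter : ∀ {A : Set} (p : A → Bool) (xs : List A) → length (filterᵇ p xs) ≡ ∑ xs (λ x → ⟦ p x ⟧)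
length-filter p L.[] = refl
length-filter p (x L.∷ xs) with p x
... | true = cong suc (length-filter p xs)
... | false = length-filter p xs

∑-++ : ∀ {A : Set} (xs ys : List A) (f : A → ℕ) → ∑ (xs L.++ ys) f ≡ ∑ xs f + ∑ ys f
∑-++ L.[] ys f = refl
∑-++ (x L.∷ xs) ys f = trans (cong (f x +_) (∑-++ xs ys f)) (≡-sym (+-assoc (f x) (∑ xs f) (∑ ys f)))

∑-map : ∀ {A B : Set} (g : A → B) (xs : List A) (f : B → ℕ) → ∑ (map g xs) f ≡ ∑ xs (f ∘ g)
∑-map g L.[] f = refl
∑-map g (x L.∷ xs) f = cong (f (g x) +_) (∑-map g xs f)

∑-concatMap : ∀ {A B : Set} (g : A → List B) (xs : List A) (f : B → ℕ) →
  ∑ (concatMap g xs) f ≡ ∑ xs (λ x → ∑ (g x) f)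
∑-concatMap g L.[] f = refl
∑-concatMap g (x L.∷ xs) f =
  trans (∑-++ (g x) (concatMap g xs) f) (cong (∑ (g x) f +_) (∑-concatMap g xs f))

==-refl : ∀ {n} (x : Fin n) → (x == x) ≡ true
==-refl x = Equivalence.to T-≡ (≡⇒≡ᵇ (toℕ x) (toℕ x) refl)

==-sound : ∀ {n} (x y : Fin n) → (x == y) ≡ true → x ≡ y
==-sound x y e = toℕ-injective (≡ᵇ⇒≡ (toℕ x) (toℕ y) (Equivalence.from T-≡ e))

==-sym : ∀ {n} (x y : Fin n) → (x == y) ≡ (y == x)
==-sym x y = ≡ᵇ-sym (toℕ x) (toℕ y)
  where
  ≡ᵇ-sym : ∀ i j → (i ≡ᵇ j) ≡ (j ≡ᵇ i)
  ≡ᵇ-sym zero zero = refl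
  ≡ᵇ-sym zero (suc j) = refl
  ≡ᵇ-sym (suc i) zero = refl
  ≡ᵇ-sym (suc i) (suc j) = ≡ᵇ-sym i j

∑F : (n : ℕ) → (Fin n → ℕ) → ℕ
∑F n g = ∑ (allFin n) g

∑F-suc : ∀ n (g : Fin (suc n) → ℕ) → ∑F (suc n) g ≡ g F.zero + ∑F n (g ∘ F.suc)
∑F-suc n g = cong (g F.zero +_) (cong sum
  (trans (map-tabulate F.suc g) (≡-sym (map-tabulate id (g ∘ F.suc)))))

∑F-const : ∀ n c → ∑F n (λ _ → c) ≡ n * c
∑F-const n c = trans (∑-const (allFin n) c) (cong (_* c) (length-tabulate {n = n} id))

∑F-delta : ∀ n (x : Fin n) (g : Fin n → ℕ) → ∑F n (λ y → ⟦ x == y ⟧ * g y) ≡ g x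
∑F-delta (suc n) F.zero g = begin
    ∑F (suc n) (λ y → ⟦ F.zero == y ⟧ * g y) ≡⟨ ∑F-suc n (λ y → ⟦ F.zero == y ⟧ * g y) ⟩
    g F.zero + 0 + ∑F n (λ _ → 0)           ≡⟨ cong (g F.zero + 0 +_) (∑F-const n 0) ⟩
    g F.zero + 0 + n * 0                    ≡⟨ cong (g F.zero + 0 +_) (*-zeroʳ n) ⟩
    g F.zero + 0 + 0                        ≡⟨ +-identityʳ _ ⟩
    g F.zero + 0                            ≡⟨ +-identityʳ _ ⟩
    g F.zero ∎
  where open ≡-Reasoning
∑F-delta (suc n) (F.suc x) g =
  trans (∑F-suc n (λ y → ⟦ F.suc x == y ⟧ * g y)) (∑F-delta n x (g ∘ F.suc))

∑F-indicator : ∀ n (x : Fin n) → ∑F n (λ y → ⟦ x == y ⟧) ≡ 1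
∑F-indicator n x =
  trans (∑-cong (allFin n) (λ y → ≡-sym (*-identityʳ ⟦ x == y ⟧))) (∑F-delta n x (λ _ → 1))

-- Relabelling vertices by involutions

Invol : ∀ {n} → (Fin n → Fin n) → Set
Invol {n} σ = ∀ x → σ (σ x) ≡ x

invol-adj : ∀ {n} (σ : Fin n → Fin n) → Invol σ → ∀ x y → (σ x == y) ≡ (x == σ y)
invol-adj σ inv x y with x == σ y in e
... | true with ==-sound x (σ y) e
...   | refl = trans (cong (_== y) (inv y)) (==-refl y)
invol-adj σ inv x y | false with σ x == y in e′
... | false = refl
... | true with ==-sound (σ x) y e′
...   | refl = trans (≡-sym (==-refl x)) (trans (cong (x ==_) (≡-sym (inv x))) e)

invol-inj : ∀ {n} (σ : Fin n → Fin n) → Invol σ → ∀ x y → (σ x == σ y) ≡ (x == y)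
invol-inj σ inv x y = trans (invol-adj σ inv x (σ y)) (cong (x ==_) (inv y))

∑F-relabel : ∀ n (σ : Fin n → Fin n) → Invol σ → ∀ g → ∑F n (g ∘ σ) ≡ ∑F n g
∑F-relabel n σ inv g = begin
    ∑F n (g ∘ σ)
      ≡⟨ ∑-cong (allFin n) (λ x → ≡-sym (∑F-delta n (σ x) g)) ⟩
    ∑F n (λ x → ∑F n (λ y → ⟦ σ x == y ⟧ * g y))
      ≡⟨ ∑-swap (allFin n) (allFin n) _ ⟩
    ∑F n (λ y → ∑F n (λ x → ⟦ σ x == y ⟧ * g y))
      ≡⟨ ∑-cong (allFin n) (λ y → ∑-cong (allFin n) (λ x → cong (λ b → ⟦ b ⟧ * g y)
           (trans (invol-adj σ inv x y) (==-sym x (σ y))))) ⟩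
    ∑F n (λ y → ∑F n (λ x → ⟦ σ y == x ⟧ * g y))
      ≡⟨ ∑-cong (allFin n) (λ y → ∑-*ʳ (allFin n) _ (g y)) ⟩
    ∑F n (λ y → ∑F n (λ x → ⟦ σ y == x ⟧) * g y)
      ≡⟨ ∑-cong (allFin n) (λ y → trans (cong (_* g y) (∑F-indicator n (σ y))) (*-identityˡ (g y))) ⟩
    ∑F n g ∎
  where open ≡-Reasoning

transpose : ∀ {n} → Fin n → Fin n → Fin n → Fin n
transpose a b x = if x == a then b else (if x == b then a else x)

transpose-invol : ∀ {n} (a b : Fin n) → Invol (transpose a b)
transpose-invol a b x with x == a in e₁
... | true with ==-sound x a e₁
...   | refl with b == a in e₃
...     | true = ==-sound b a e₃
...     | false rewrite ==-refl b = refl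
transpose-invol a b x | false with x == b in e₂
... | true with ==-sound x b e₂
...   | refl rewrite ==-refl a = refl
transpose-invol a b x | false | false rewrite e₁ | e₂ = refl

-- Sums over arrival orders

∑V : (n m : ℕ) → (Vec (Fin n) m → ℕ) → ℕ
∑V n m f = ∑ (allVecs m (allFin n)) f

∑V-suc : ∀ n m (f : Vec (Fin n) (suc m) → ℕ) → ∑V n (suc m) f ≡ ∑F n (λ x → ∑V n m (f ∘ (x ∷_)))
∑V-suc n m f = trans (∑-concatMap (λ x → map (x ∷_) (allVecs m (allFin n))) (allFin n) f)
  (∑-cong (allFin n) (λ x → ∑-map (x ∷_) (allVecs m (allFin n)) f))

∑V-relabel : ∀ n (σ : Fin n → Fin n) → Invol σ → ∀ m (f : Vec (Fin n) m → ℕ) →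
  ∑V n m (f ∘ V.map σ) ≡ ∑V n m f
∑V-relabel n σ inv zero f = refl
∑V-relabel n σ inv (suc m) f = begin
    ∑V n (suc m) (f ∘ V.map σ)
      ≡⟨ ∑V-suc n m (f ∘ V.map σ) ⟩
    ∑F n (λ x → ∑V n m (λ v → f (σ x ∷ V.map σ v)))
      ≡⟨ ∑-cong (allFin n) (λ x → ∑V-relabel n σ inv m (f ∘ (σ x ∷_))) ⟩
    ∑F n (λ x → ∑V n m (f ∘ (σ x ∷_)))
      ≡⟨ ∑F-relabel n σ inv (λ y → ∑V n m (f ∘ (y ∷_))) ⟩
    ∑F n (λ x → ∑V n m (f ∘ (x ∷_)))
      ≡⟨ ≡-sym (∑V-suc n m f) ⟩
    ∑V n (suc m) f ∎
  where open ≡-Reasoning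

all-cong : ∀ {A : Set} {p q : A → Bool} → (∀ x → p x ≡ q x) → ∀ xs → all p xs ≡ all q xs
all-cong e L.[] = refl
all-cong e (x L.∷ xs) = cong₂ _∧_ (e x) (all-cong e xs)

isPerm-relabel : ∀ {n} (σ : Fin n → Fin n) → Invol σ → ∀ (π : Vec (Fin n) n) →
  isPerm (V.map σ π) ≡ isPerm π
isPerm-relabel {n} σ inv π = all-cong (λ i → all-cong (λ j →
    cong (λ b → (i == j) ∨ not b)
      (trans (cong₂ _==_ (lookup-map i σ π) (lookup-map j σ π))
             (invol-inj σ inv (lookup π i) (lookup π j))))
    (allFin n)) (allFin n)

∑-perms-relabel : ∀ n (σ : Fin n → Fin n) → Invol σ → ∀ (f : Vec (Fin n) n → ℕ) →
  ∑ (perms n) (f ∘ V.map σ) ≡ ∑ (perms n) f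
∑-perms-relabel n σ inv f = begin
    ∑ (perms n) (f ∘ V.map σ)
      ≡⟨ ∑-filter isPerm (allVecs n (allFin n)) (f ∘ V.map σ) ⟩
    ∑V n n (λ v → ⟦ isPerm v ⟧ * f (V.map σ v))
      ≡⟨ ∑-cong (allVecs n (allFin n))
           (λ v → cong (λ b → ⟦ b ⟧ * f (V.map σ v)) (≡-sym (isPerm-relabel σ inv v))) ⟩
    ∑V n n (weighted ∘ V.map σ)
      ≡⟨ ∑V-relabel n σ inv n weighted ⟩
    ∑V n n weighted
      ≡⟨ ≡-sym (∑-filter isPerm (allVecs n (allFin n)) f) ⟩
    ∑ (perms n) f ∎
  where
  open ≡-Reasoning
  weighted : Vec (Fin n) n → ℕ
  weighted v = ⟦ isPerm v ⟧ * f v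

first : ∀ {A : Set} {m} → Vec A (suc m) → A
first π = lookup π F.zero

headCount : ∀ m → Fin (suc m) → ℕ
headCount m a = ∑ (perms (suc m)) (λ π → ⟦ first π == a ⟧)

headCount-uniform : ∀ m a → headCount m a ≡ headCount m F.zero
headCount-uniform m a = begin
    headCount m a
      ≡⟨ ∑-cong (perms n) (λ π → cong ⟦_⟧ (≡-sym (invol-adj σ inv (first π) F.zero))) ⟩
    ∑ (perms n) (λ π → ⟦ σ (first π) == F.zero ⟧)
      ≡⟨ ∑-cong (perms n) (λ π → cong (λ x → ⟦ x == F.zero ⟧) (≡-sym (lookup-map F.zero σ π))) ⟩
    ∑ (perms n) (λ π → ⟦ first (V.map σ π) == F.zero ⟧)
      ≡⟨ ∑-perms-relabel n σ inv (λ π → ⟦ first π == F.zero ⟧) ⟩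
    headCount m F.zero ∎
  where
  open ≡-Reasoning
  n = suc m
  σ = transpose F.zero a
  inv = transpose-invol F.zero a

∑-by-first : ∀ m (g : Fin (suc m) → ℕ) → ∑ (perms (suc m)) (g ∘ first) ≡ headCount m F.zero * ∑F (suc m) g
∑-by-first m g = begin
    ∑ (perms n) (g ∘ first)
      ≡⟨ ∑-cong (perms n) (λ π → ≡-sym (∑F-delta n (first π) g)) ⟩
    ∑ (perms n) (λ π → ∑F n (λ a → ⟦ first π == a ⟧ * g a))
      ≡⟨ ∑-swap (perms n) (allFin n) _ ⟩
    ∑F n (λ a → ∑ (perms n) (λ π → ⟦ first π == a ⟧ * g a))
      ≡⟨ ∑-cong (allFin n) (λ a → ∑-*ʳ (perms n) _ (g a)) ⟩
    ∑F n (λ a → headCount m a * g a)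
      ≡⟨ ∑-cong (allFin n) (λ a → cong (_* g a) (headCount-uniform m a)) ⟩
    ∑F n (λ a → headCount m F.zero * g a)
      ≡⟨ ∑-*ˡ (allFin n) (headCount m F.zero) g ⟩
    headCount m F.zero * ∑F n g ∎
  where
  open ≡-Reasoning
  n = suc m

length-perms : ∀ m → length (perms (suc m)) ≡ suc m * headCount m F.zero
length-perms m = begin
    length (perms (suc m))                ≡⟨ ≡-sym (*-identityʳ _) ⟩
    length (perms (suc m)) * 1            ≡⟨ ≡-sym (∑-const (perms (suc m)) 1) ⟩
    ∑ (perms (suc m)) (λ _ → 1)           ≡⟨ ∑-by-first m (λ _ → 1) ⟩
    headCount m F.zero * ∑F (suc m) (λ _ → 1) ≡⟨ cong (headCount m F.zero *_) (∑F-const (suc m) 1) ⟩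
    headCount m F.zero * (suc m * 1)      ≡⟨ cong (headCount m F.zero *_) (*-identityʳ (suc m)) ⟩
    headCount m F.zero * suc m            ≡⟨ *-comm (headCount m F.zero) (suc m) ⟩
    suc m * headCount m F.zero ∎
  where open ≡-Reasoning

-- Star cuts and the handshake bound

count-as-∑ : ∀ n (p : Fin n → Bool) → count n p ≡ ∑F n (λ j → ⟦ p j ⟧)
count-as-∑ n p = length-filter p (allFin n)

cutSize-cong : ∀ {n} (G : Graph n) {s s′ : Partition n} → (∀ v → s v ≡ s′ v) → cutSize G s ≡ cutSize G s′
cutSize-cong {n} G e = ∑-cong (allFin n) (λ i → trans (count-as-∑ n _) (trans
  (∑-cong (allFin n) (λ j → cong (λ b → ⟦ (toℕ i <ᵇ toℕ j) ∧ adj G i j ∧ b ⟧) (cong₂ _xor_ (e i) (e j))))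
  (≡-sym (count-as-∑ n _))))

-- the star of u: the cut separating u from all other vertices (its size is deg u)
star : ∀ {n} → Graph n → Fin n → ℕ
star G u = cutSize G (u ==_)

-- an edge is cut only if one of its endpoints is in the part being separated
cut-indicator-≤ : ∀ a c p q → ⟦ a ∧ c ∧ (p xor q) ⟧ ≤ ⟦ a ∧ c ⟧ * (⟦ p ⟧ + ⟦ q ⟧)
cut-indicator-≤ false c p q = z≤n
cut-indicator-≤ true false p q = z≤n
cut-indicator-≤ true true false false = z≤n
cut-indicator-≤ true true false true = s≤s z≤n
cut-indicator-≤ true true true false = s≤s z≤n
cut-indicator-≤ true true true true = z≤n

∑F-endpoints : ∀ n (i j : Fin n) → ∑F n (λ u → ⟦ u == i ⟧ + ⟦ u == j ⟧) ≡ 2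
∑F-endpoints n i j = trans (∑-+ (allFin n) _ _) (cong₂ _+_ (endpoint i) (endpoint j))
  where
  endpoint : ∀ x → ∑F n (λ u → ⟦ u == x ⟧) ≡ 1
  endpoint x = trans (∑-cong (allFin n) (λ u → cong ⟦_⟧ (==-sym u x))) (∑F-indicator n x)

∑-star≤2|E| : ∀ {n} (G : Graph n) → ∑F n (star G) ≤ 2 * numEdges G
∑-star≤2|E| {n} G = begin
    ∑F n (star G)
      ≡⟨ ∑-cong (allFin n) (λ u → ∑-cong (allFin n) (λ i → count-as-∑ n _)) ⟩
    ∑F n (λ u → ∑F n (λ i → ∑F n (λ j → ⟦ (toℕ i <ᵇ toℕ j) ∧ adj G i j ∧ ((u == i) xor (u == j)) ⟧)))
      ≤⟨ ∑-mono (allFin n) (λ u → ∑-mono (allFin n) (λ i → ∑-mono (allFin n) (λ j →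
           cut-indicator-≤ (toℕ i <ᵇ toℕ j) (adj G i j) (u == i) (u == j)))) ⟩
    ∑F n (λ u → ∑F n (λ i → ∑F n (λ j → E i j * (⟦ u == i ⟧ + ⟦ u == j ⟧))))
      ≡⟨ ∑-swap (allFin n) (allFin n) _ ⟩
    ∑F n (λ i → ∑F n (λ u → ∑F n (λ j → E i j * (⟦ u == i ⟧ + ⟦ u == j ⟧))))
      ≡⟨ ∑-cong (allFin n) (λ i → ∑-swap (allFin n) (allFin n) _) ⟩
    ∑F n (λ i → ∑F n (λ j → ∑F n (λ u → E i j * (⟦ u == i ⟧ + ⟦ u == j ⟧))))
      ≡⟨ ∑-cong (allFin n) (λ i → ∑-cong (allFin n) (λ j →
           trans (∑-*ˡ (allFin n) (E i j) _) (cong (E i j *_) (∑F-endpoints n i j)))) ⟩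
    ∑F n (λ i → ∑F n (λ j → E i j * 2))
      ≡⟨ ∑-cong (allFin n) (λ i → ∑-*ʳ (allFin n) (E i) 2) ⟩
    ∑F n (λ i → ∑F n (E i) * 2)
      ≡⟨ ∑-*ʳ (allFin n) (λ i → ∑F n (E i)) 2 ⟩
    ∑F n (λ i → ∑F n (E i)) * 2
      ≡⟨ cong (_* 2) (∑-cong (allFin n) (λ i → ≡-sym (count-as-∑ n _))) ⟩
    numEdges G * 2
      ≡⟨ *-comm (numEdges G) 2 ⟩
    2 * numEdges G ∎
  where
  open ≤-Reasoning
  E : Fin n → Fin n → ℕ
  E i j = ⟦ (toℕ i <ᵇ toℕ j) ∧ adj G i j ⟧

-- The algorithm: the first vertex goes to X, all later vertices to Y

isolateFirst : OnlineAlg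
isolateFirst zero _ _ _ = true
isolateFirst (suc k) _ _ _ = false

run-isolateFirst : ∀ {n} (G : Graph n) k (f : Fin (suc k) → Fin n) →
  run isolateFirst G (suc k) f ≡ true ∷ V.replicate k false
run-isolateFirst G zero f = refl
run-isolateFirst G (suc k) f rewrite run-isolateFirst G k (f ∘ F.inject₁) =
  cong (true ∷_) (replicate-∷ʳ k)
  where
  replicate-∷ʳ : ∀ k → V.replicate k false V.∷ʳ false ≡ V.replicate (suc k) false
  replicate-∷ʳ zero = refl
  replicate-∷ʳ (suc k) = cong (false ∷_) (replicate-∷ʳ k)

any-false : ∀ {A : Set} (p : A → Bool) k (g : Fin k → A) → (∀ i → p (g i) ≡ false) → any p (tabulate g) ≡ false
any-false p zero g e = refl
any-false p (suc k) g e rewrite e F.zero = any-false p k (g ∘ F.suc) (e ∘ F.suc)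

finalPartition-isolateFirst : ∀ m (G : Graph (suc m)) (π : Vec (Fin (suc m)) (suc m)) v →
  finalPartition isolateFirst G π v ≡ (first π == v)
finalPartition-isolateFirst m G π v rewrite run-isolateFirst G m (lookup π) =
  trans (cong₂ _∨_ (∧-identityʳ (first π == v)) (any-false _ m F.suc later-in-Y)) (∨-identityʳ _)
  where
  later-in-Y : ∀ t → ((lookup π (F.suc t) == v) ∧ lookup (V.replicate m false) t) ≡ false
  later-in-Y t = trans (cong ((lookup π (F.suc t) == v) ∧_) (lookup-replicate t false)) (∧-zeroʳ _)

isolateFirst-valid : ∀ m (G : Graph (suc (suc m))) (π : Vec (Fin (suc (suc m))) (suc (suc m))) →
  ValidPartition (finalPartition isolateFirst G π)
isolateFirst-valid m G π =
    (first π , trans (finalPartition-isolateFirst (suc m) G π (first π)) (==-refl (first π)))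
  , other (first π) refl
  where
  other : ∀ x → first π ≡ x → Σ (Fin (suc (suc m))) (λ v → finalPartition isolateFirst G π v ≡ false)
  other F.zero e = F.suc F.zero , trans (finalPartition-isolateFirst (suc m) G π _) (cong (_== F.suc F.zero) e)
  other (F.suc x) e = F.zero , trans (finalPartition-isolateFirst (suc m) G π _) (cong (_== F.zero) e)

algCost-isolateFirst : ∀ m (G : Graph (suc m)) (π : Vec (Fin (suc m)) (suc m)) →
  algCost isolateFirst G π ≡ star G (first π)
algCost-isolateFirst m G π = cutSize-cong G (finalPartition-isolateFirst m G π)

isolateFirst-sparse-bound : ∀ m (G : Graph (suc m)) C → numEdges G ≤ C * suc m →
  totalCost isolateFirst G ≤ length (perms (suc m)) * (2 * C)
isolateFirst-sparse-bound m G C sparse = begin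
    totalCost isolateFirst G
      ≡⟨ ∑-cong (perms n) (algCost-isolateFirst m G) ⟩
    ∑ (perms n) (star G ∘ first)
      ≡⟨ ∑-by-first m (star G) ⟩
    N * ∑F n (star G)
      ≤⟨ *-monoʳ-≤ N (≤-trans (∑-star≤2|E| G) (*-monoʳ-≤ 2 sparse)) ⟩
    N * (2 * (C * n))
      ≡⟨ rearrange N C n ⟩
    (n * N) * (2 * C)
      ≡⟨ cong (_* (2 * C)) (≡-sym (length-perms m)) ⟩
    length (perms n) * (2 * C) ∎
  where
  open ≤-Reasoning
  n = suc m
  N = headCount m F.zero
  rearrange : ∀ N C n → N * (2 * (C * n)) ≡ (n * N) * (2 * C)
  rearrange = solve-∀

theorem6 : Σ OnlineAlg λ A →
    (∀ (n : ℕ) (G : Graph n) → 2 ≤ n → Connected G →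
    ∀ (π : Vec (Fin n) n) → isPerm π ≡ true → ValidPartition (finalPartition A G π))
    × (∀ (C : ℕ) → Σ ℕ λ c → Σ ℕ λ d →
    ∀ (n : ℕ) (G : Graph n) → 2 ≤ n → Connected G → numEdges G ≤ C * n →
    ∀ (k : ℕ) → IsMinCut G k →
    totalCost A G ≤ length (perms n) * (c * k + d))
theorem6 = isolateFirst , valid , competitive
  where
  valid : ∀ (n : ℕ) (G : Graph n) → 2 ≤ n → Connected G →
    ∀ (π : Vec (Fin n) n) → isPerm π ≡ true → ValidPartition (finalPartition isolateFirst G π)
  valid (suc (suc m)) G (s≤s (s≤s z≤n)) _ π _ = isolateFirst-valid m G π
  competitive : ∀ (C : ℕ) → Σ ℕ λ c → Σ ℕ λ d →
    ∀ (n : ℕ) (G : Graph n) → 2 ≤ n → Connected G → numEdges G ≤ C * n →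
    ∀ (k : ℕ) → IsMinCut G k →
    totalCost isolateFirst G ≤ length (perms n) * (c * k + d)
  competitive C = 0 , 2 * C , λ where
    (suc m) G (s≤s _) _ sparse _ _ → isolateFirst-sparse-bound m G C sparse
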